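{- Let $k\ge 3$ be an integer and $G$ a graph. Then $\chi(G)\le k$ if and only if the signed graph $S(G)$ admits a homomorphism to $(K_{2k},M)$.
   Context: A signed graph $(G,\sigma)$ is a graph with a signature $\sigma:E(G)\to\{+,-\}$; a closed walk's sign is the product of its edge signs (with multiplicity). A homomorphism of $(G,\sigma)$ to $(H,\pi)$ maps vertices and edges of $G$ to vertices and edges of $H$ preserving adjacencies, incidences and the signs of closed walks. For a graph $G$, the signed graph $S(G)$ is obtained as follows: start with the vertex set of $G$; for each edge $uv$ of $G$ add two new vertices $x_{uv},y_{uv}$, each joined to both $u$ and $v$ (the edge $uv$ itself is not kept); in each resulting $4$-cycle $u x_{uv} v y_{uv}$ exactly one edge is negative and the others are positive. $(K_{2k},M)$ is the complete graph on $2k$ vertices whose perfect matching $M$ consists of negative edges, all other edges positive. -}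

module Defs where

open import Data.Nat using (ℕ; _*_; _/_)
open import Data.Bool using (Bool; true; false; if_then_else_)
open import Data.Fin using (Fin; toℕ; _<_)
open import Data.Product using (Σ; _×_; _,_; proj₁; proj₂)
open import Data.Sum using (_⊎_; inj₁; inj₂)
open import Data.List using (List; []; _∷_; map)
open import Relation.Binary.PropositionalEquality using (_≡_; _≢_)
open import Relation.Nullary using (¬_; does)
import Data.Nat as ℕ

data Sign : Set where
  positive negative : Sign

_·_ : Sign → Sign → Sign
positive · s = s
negative · positive = negative
negative · negative = positive

record Graph : Set where
  field
    n      : ℕ
    adj    : Fin n → Fin n → Bool
    sym    : ∀ u v → adj u v ≡ adj v u
    irrefl : ∀ u → adj u u ≡ false

Colourable : Graph → ℕ → Set
Colourable G k = Σ (Fin n → Fin k) λ c → ∀ u v → adj u v ≡ true → c u ≢ c v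
  where open Graph G

-- Signed graphs (general: arbitrary vertex and edge sets, edges with
-- two endpoints; the orientation of ends is irrelevant)

record SignedGraph : Set₁ where
  field
    V    : Set
    E    : Set
    ends : E → V × V
    σ    : E → Sign

  Joins : E → V → V → Set
  Joins e u w = ends e ≡ (u , w) ⊎ ends e ≡ (w , u)

  IsWalk : V → List (E × V) → V → Set
  IsWalk u [] v = u ≡ v
  IsWalk u ((e , w) ∷ rest) v = Joins e u w × IsWalk w rest v

  signW : List (E × V) → Sign
  signW [] = positive
  signW ((e , _) ∷ rest) = σ e · signW rest

record Hom (G H : SignedGraph) : Set where
  private
    module G = SignedGraph G
    module H = SignedGraph H
  field
    fV    : G.V → H.V
    fE    : G.E → H.E
    incid : ∀ e → H.Joins (fE e) (fV (proj₁ (G.ends e))) (fV (proj₂ (G.ends e)))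
    signs : ∀ v (W : List (G.E × G.V)) → G.IsWalk v W v →
            G.signW W ≡ H.signW (map (λ p → fE (proj₁ p) , fV (proj₂ p)) W)

module _ (G : Graph) where
  open Graph G

  GEdge : Set
  GEdge = Σ (Fin n × Fin n) λ p → (proj₁ p < proj₂ p) × (adj (proj₁ p) (proj₂ p) ≡ true)

  -- vertices: old vertices, and for each edge uv two new vertices
  -- x_uv (true) and y_uv (false)
  -- edges: (uv , which new vertex , which endpoint: false = u, true = v)
  S : SignedGraph
  S = record
    { V    = Fin n ⊎ (GEdge × Bool)
    ; E    = GEdge × Bool × Bool
    ; ends = λ { (e , b , false) → inj₁ (proj₁ (proj₁ e)) , inj₂ (e , b)
               ; (e , b , true)  → inj₁ (proj₂ (proj₁ e)) , inj₂ (e , b) }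
    -- in the 4-cycle u x_uv v y_uv exactly the edge u x_uv is negative
    ; σ    = λ { (e , true , false) → negative
               ; (e , true , true)  → positive
               ; (e , false , _)    → positive }
    }

-- (K_{2k}, M): complete graph on Fin (2 * k), with the perfect matching
-- M = { {2i, 2i+1} } negative, all other edges positive.

KM : ℕ → SignedGraph
KM k = record
  { V    = Fin (2 * k)
  ; E    = Σ (Fin (2 * k) × Fin (2 * k)) λ p → proj₁ p < proj₂ p
  ; ends = proj₁
  ; σ    = λ e → if does (toℕ (proj₁ (proj₁ e)) / 2 ℕ.≟ toℕ (proj₂ (proj₁ e)) / 2)
                 then negative else positive
  }

-- The vertices of (K_{2k}, M) come in k matched pairs {2i, 2i+1}, and an edge is
-- negative exactly when its ends lie in the same pair; so mapping a vertex to its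
-- pair is the natural candidate for a k-colouring.  If a homomorphism put both ends
-- of an edge uv of G into the same pair, the negative 4-cycle u x_uv v y_uv of S(G)
-- would be mapped to a closed walk whose four edge signs cancel in pairs, hence to
-- a positive one.  Conversely, from a proper colouring c send u to 2c(u), x_uv to
-- 2c(u)+1 (its matched partner, making u x_uv negative) and y_uv to 2l for a colour
-- l ∉ {c(u), c(v)}, which exists because k ≥ 3; every edge then keeps its sign.
module Submission where

open import Defs
open import Data.Nat using (ℕ; _≤_; _+_; _*_; _/_; s≤s)
import Data.Nat as ℕ
open import Data.Nat.Properties using (*-comm; +-identityʳ; +-cancelˡ-≡)
open import Data.Nat.DivMod using (m*n/n≡m; +-distrib-/-∣ˡ; m<n⇒m/n≡0; m<n*o⇒m/o<n)
open import Data.Nat.Divisibility using (n∣m*n)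
open import Data.Fin using (Fin; zero; suc; toℕ; fromℕ<; cast; combine)
open import Data.Fin.Properties
  using (toℕ<n; toℕ-cast; toℕ-combine; toℕ-fromℕ<; toℕ-injective; <-cmp)
  renaming (_≟_ to _≟ᶠ_)
open import Data.Bool using (true; false; if_then_else_)
open import Data.Product using (Σ; Σ-syntax; _×_; _,_; proj₁; proj₂)
import Data.Product as Product
open import Data.Sum using (inj₁; inj₂)
import Data.Sum as Sum
open import Data.List using (List; []; _∷_; map)
open import Function using (_∘_)
open import Function.Bundles using (_⇔_; mk⇔)
open import Relation.Binary using (tri<; tri≈; tri>)
open import Relation.Binary.PropositionalEquality
open import Relation.Nullary using (Dec; yes; no; does; contradiction)
open import Relation.Nullary.Decidable using (dec-true; dec-false)

open ≡-Reasoning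

s·[s·t]≡t : ∀ s t → s · (s · t) ≡ t
s·[s·t]≡t positive t        = refl
s·[s·t]≡t negative positive = refl
s·[s·t]≡t negative negative = refl

-- Definitionally the sign that KM gives an edge between the pairs i and j.
matchSign : ℕ → ℕ → Sign
matchSign i j = if does (i ℕ.≟ j) then negative else positive

matchSign-refl : ∀ i → matchSign i i ≡ negative
matchSign-refl i rewrite dec-true (i ℕ.≟ i) refl = refl

matchSign-≢ : ∀ {i j} → i ≢ j → matchSign i j ≡ positive
matchSign-≢ {i} {j} i≢j rewrite dec-false (i ℕ.≟ j) i≢j = refl

matchSign-sym : ∀ i j → matchSign i j ≡ matchSign j i
matchSign-sym i j = by-cases (i ℕ.≟ j)
  where
  by-cases : Dec (i ≡ j) → matchSign i j ≡ matchSign j i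
  by-cases (yes refl) = refl
  by-cases (no i≢j)   = trans (matchSign-≢ i≢j) (sym (matchSign-≢ (i≢j ∘ sym)))

matchSign-square : ∀ {a b} x y → a ≡ b →
  matchSign a x · (matchSign x b · (matchSign b y · (matchSign y a · positive))) ≡ positive
matchSign-square {a} x y refl = begin
  matchSign a x · (matchSign x a · (matchSign a y · (matchSign y a · positive)))
    ≡⟨ cong₂ (λ s t → matchSign a x · (s · (matchSign a y · (t · positive))))
             (matchSign-sym x a) (matchSign-sym y a) ⟩
  matchSign a x · (matchSign a x · (matchSign a y · (matchSign a y · positive)))
    ≡⟨ s·[s·t]≡t (matchSign a x) _ ⟩
  matchSign a y · (matchSign a y · positive)
    ≡⟨ s·[s·t]≡t (matchSign a y) positive ⟩
  positive ∎

module _ {G H : SignedGraph} where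
  private
    module G = SignedGraph G
    module H = SignedGraph H

  signW-map : (fV : G.V → H.V) (fE : G.E → H.E) → (∀ e → H.σ (fE e) ≡ G.σ e) →
              ∀ W → G.signW W ≡ H.signW (map (λ p → fE (proj₁ p) , fV (proj₂ p)) W)
  signW-map fV fE σ-pres []            = refl
  signW-map fV fE σ-pres ((e , _) ∷ W) = cong₂ _·_ (sym (σ-pres e)) (signW-map fV fE σ-pres W)

  signPreserving⇒Hom : (fV : G.V → H.V) (fE : G.E → H.E) →
    (∀ e → H.Joins (fE e) (fV (proj₁ (G.ends e))) (fV (proj₂ (G.ends e)))) →
    (∀ e → H.σ (fE e) ≡ G.σ e) → Hom G H
  signPreserving⇒Hom fV fE incid σ-pres = record
    { fV = fV ; fE = fE ; incid = incid ; signs = λ _ W _ → signW-map fV fE σ-pres W }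

  module _ (f : Hom G H) where
    open Hom f

    Hom-Joins : ∀ {e u w} → G.Joins e u w → H.Joins (fE e) (fV u) (fV w)
    Hom-Joins {e} (inj₁ refl) = incid e
    Hom-Joins {e} (inj₂ refl) = Sum.swap (incid e)

    Hom-IsWalk : ∀ {u} W {v} → G.IsWalk u W v →
                 H.IsWalk (fV u) (map (λ p → fE (proj₁ p) , fV (proj₂ p)) W) (fV v)
    Hom-IsWalk []      refl       = refl
    Hom-IsWalk (_ ∷ W) (j , walk) = Hom-Joins j , Hom-IsWalk W walk

pairIndex : ∀ {n} → Fin n → ℕ
pairIndex a = toℕ a / 2

pairVertex : ∀ {k} → Fin k → Fin 2 → Fin (2 * k)
pairVertex {k} i j = cast (*-comm k 2) (combine i j)

toℕ-pairVertex : ∀ {k} (i : Fin k) j → toℕ (pairVertex i j) ≡ toℕ i * 2 + toℕ j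
toℕ-pairVertex {k} i j = begin
  toℕ (pairVertex i j) ≡⟨ toℕ-cast (*-comm k 2) (combine i j) ⟩
  toℕ (combine i j)    ≡⟨ toℕ-combine i j ⟩
  2 * toℕ i + toℕ j    ≡⟨ cong (_+ toℕ j) (*-comm 2 (toℕ i)) ⟩
  toℕ i * 2 + toℕ j    ∎

pairIndex-pairVertex : ∀ {k} (i : Fin k) j → pairIndex (pairVertex i j) ≡ toℕ i
pairIndex-pairVertex i j = begin
  toℕ (pairVertex i j) / 2    ≡⟨ cong (_/ 2) (toℕ-pairVertex i j) ⟩
  (toℕ i * 2 + toℕ j) / 2     ≡⟨ +-distrib-/-∣ˡ (toℕ j) (n∣m*n (toℕ i)) ⟩
  toℕ i * 2 / 2 + toℕ j / 2   ≡⟨ cong₂ _+_ (m*n/n≡m (toℕ i) 2) (m<n⇒m/n≡0 (toℕ<n j)) ⟩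
  toℕ i + 0                   ≡⟨ +-identityʳ (toℕ i) ⟩
  toℕ i                       ∎

pairVertex-injectiveʳ : ∀ {k} (i : Fin k) {j l} → pairVertex i j ≡ pairVertex i l → j ≡ l
pairVertex-injectiveʳ i {j} {l} eq = toℕ-injective (+-cancelˡ-≡ (toℕ i * 2) (toℕ j) (toℕ l) (begin
  toℕ i * 2 + toℕ j    ≡⟨ toℕ-pairVertex i j ⟨
  toℕ (pairVertex i j) ≡⟨ cong toℕ eq ⟩
  toℕ (pairVertex i l) ≡⟨ toℕ-pairVertex i l ⟩
  toℕ i * 2 + toℕ l    ∎))

pairOf : ∀ {k} → Fin (2 * k) → Fin k
pairOf {k} a = fromℕ< (m<n*o⇒m/o<n (subst (toℕ a ℕ.<_) (*-comm 2 k) (toℕ<n a)))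

toℕ-pairOf : ∀ {k} (a : Fin (2 * k)) → toℕ (pairOf {k} a) ≡ pairIndex a
toℕ-pairOf a = toℕ-fromℕ< _

module KM-Properties (k : ℕ) where
  private module K = SignedGraph (KM k)

  KM-σ-Joins : ∀ e {a b} → K.Joins e a b → K.σ e ≡ matchSign (pairIndex a) (pairIndex b)
  KM-σ-Joins _ {a} {b} (inj₁ refl) = refl
  KM-σ-Joins _ {a} {b} (inj₂ refl) = matchSign-sym (pairIndex b) (pairIndex a)

  KM-edge : ∀ {a b} → a ≢ b → Σ K.E λ e → K.Joins e a b
  KM-edge {a} {b} a≢b with <-cmp a b
  ... | tri< a<b _ _ = ((a , b) , a<b) , inj₁ refl
  ... | tri≈ _ a≡b _ = contradiction a≡b a≢b
  ... | tri> _ _ b<a = ((b , a) , b<a) , inj₂ refl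

  pairSignW : Fin (2 * k) → List (K.E × Fin (2 * k)) → Sign
  pairSignW a []            = positive
  pairSignW a ((_ , b) ∷ W) = matchSign (pairIndex a) (pairIndex b) · pairSignW b W

  KM-signW : ∀ {a} W {b} → K.IsWalk a W b → K.signW W ≡ pairSignW a W
  KM-signW []            _          = refl
  KM-signW ((e , _) ∷ W) (j , walk) = cong₂ _·_ (KM-σ-Joins e j) (KM-signW W walk)

  KM-Hom : {G : SignedGraph} (fV : SignedGraph.V G → Fin (2 * k)) →
    (let open SignedGraph G in ∀ e → fV (proj₁ (ends e)) ≢ fV (proj₂ (ends e))) →
    (let open SignedGraph G in
       ∀ e → matchSign (pairIndex (fV (proj₁ (ends e)))) (pairIndex (fV (proj₂ (ends e)))) ≡ σ e) →
    Hom G (KM k)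
  KM-Hom {G} fV distinct σ-pres = signPreserving⇒Hom fV (proj₁ ∘ edge) (proj₂ ∘ edge)
    (λ e → trans (KM-σ-Joins (proj₁ (edge e)) (proj₂ (edge e))) (σ-pres e))
    where
    open SignedGraph G using (E; ends)

    edge : (e : E) → Σ K.E λ e′ → K.Joins e′ (fV (proj₁ (ends e))) (fV (proj₂ (ends e)))
    edge e = KM-edge (distinct e)

avoid-zero : ∀ {m} (j : Fin (3 + m)) → Σ[ l ∈ Fin (3 + m) ] l ≢ zero × l ≢ j
avoid-zero j with j ≟ᶠ suc zero
... | yes refl = suc (suc zero) , (λ ()) , (λ ())
... | no j≢1   = suc zero , (λ ()) , j≢1 ∘ sym

avoid-two : ∀ {k} → 3 ≤ k → (i j : Fin k) → Σ[ l ∈ Fin k ] l ≢ i × l ≢ j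
avoid-two (s≤s (s≤s (s≤s _))) i j with i ≟ᶠ zero | j ≟ᶠ zero
... | yes refl | _        = avoid-zero j
... | no _     | yes refl = Product.map₂ Product.swap (avoid-zero i)
... | no i≢0   | no j≢0   = zero , i≢0 ∘ sym , j≢0 ∘ sym

module _ (G : Graph) where
  open Graph G using (n; adj; irrefl)
  open SignedGraph (S G) using (V; E; IsWalk; signW)

  adj-elim : (P : Fin n → Fin n → Set) → (∀ {u v} → P u v → P v u) →
             ((e : GEdge G) → P (proj₁ (proj₁ e)) (proj₂ (proj₁ e))) →
             ∀ u v → adj u v ≡ true → P u v
  adj-elim P P-sym onEdge u v uv with <-cmp u v
  ... | tri< u<v _ _  = onEdge ((u , v) , u<v , uv)
  ... | tri≈ _ refl _ = contradiction (trans (sym uv) (irrefl u)) (λ ())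
  ... | tri> _ _ v<u  = P-sym (onEdge ((v , u) , v<u , trans (Graph.sym G v u) uv))

  fourCycle : GEdge G → List (E × V)
  fourCycle e@((u , v) , _) =
    ((e , true , false) , inj₂ (e , true)) ∷ ((e , true , true) , inj₁ v) ∷
    ((e , false , true) , inj₂ (e , false)) ∷ ((e , false , false) , inj₁ u) ∷ []

  fourCycle-isWalk : (e : GEdge G) → IsWalk (inj₁ (proj₁ (proj₁ e))) (fourCycle e) (inj₁ (proj₁ (proj₁ e)))
  fourCycle-isWalk _ = inj₁ refl , inj₂ refl , inj₁ refl , inj₂ refl , refl

  fourCycle-negative : (e : GEdge G) → signW (fourCycle e) ≡ negative
  fourCycle-negative _ = refl

  module _ {k : ℕ} (f : Hom (S G) (KM k)) where
    open Hom f
    open KM-Properties k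

    Hom⇒pairIndex-≢ : (e : GEdge G) →
      pairIndex (fV (inj₁ (proj₁ (proj₁ e)))) ≢ pairIndex (fV (inj₁ (proj₂ (proj₁ e))))
    Hom⇒pairIndex-≢ e same = contradiction negative≡positive (λ ())
      where
      u = inj₁ (proj₁ (proj₁ e))

      image : List (SignedGraph.E (KM k) × Fin (2 * k))
      image = map (λ p → fE (proj₁ p) , fV (proj₂ p)) (fourCycle e)

      negative≡positive : negative ≡ positive
      negative≡positive = begin
        negative                       ≡⟨ fourCycle-negative e ⟨
        signW (fourCycle e)            ≡⟨ signs u (fourCycle e) (fourCycle-isWalk e) ⟩
        SignedGraph.signW (KM k) image ≡⟨ KM-signW image (Hom-IsWalk f (fourCycle e) (fourCycle-isWalk e)) ⟩
        pairSignW (fV u) image         ≡⟨ matchSign-square _ _ same ⟩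
        positive                       ∎

    Hom⇒Colourable : Colourable G k
    Hom⇒Colourable = colour , adj-elim (λ u v → colour u ≢ colour v) (_∘ sym) proper
      where
      colour : Fin n → Fin k
      colour u = pairOf {k} (fV (inj₁ u))

      proper : (e : GEdge G) → colour (proj₁ (proj₁ e)) ≢ colour (proj₂ (proj₁ e))
      proper e@((u , v) , _) eq = Hom⇒pairIndex-≢ e (begin
        pairIndex (fV (inj₁ u)) ≡⟨ toℕ-pairOf {k} (fV (inj₁ u)) ⟨
        toℕ (colour u)          ≡⟨ cong toℕ eq ⟩
        toℕ (colour v)          ≡⟨ toℕ-pairOf {k} (fV (inj₁ v)) ⟩
        pairIndex (fV (inj₁ v)) ∎)

  Colourable⇒Hom : ∀ {k} → 3 ≤ k → Colourable G k → Hom (S G) (KM k)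
  Colourable⇒Hom {k} 3≤k (c , proper) = KM-Hom vertex distinct σ-pres
    where
    open KM-Properties k
    open SignedGraph (S G) using (ends; σ)

    fresh : (e : GEdge G) → Σ[ l ∈ Fin k ] l ≢ c (proj₁ (proj₁ e)) × l ≢ c (proj₂ (proj₁ e))
    fresh ((u , v) , _) = avoid-two 3≤k (c u) (c v)

    colour : V → Fin k
    colour (inj₁ u)           = c u
    colour (inj₂ (e , true))  = c (proj₁ (proj₁ e))
    colour (inj₂ (e , false)) = proj₁ (fresh e)

    parity : V → Fin 2
    parity (inj₂ (_ , true)) = suc zero
    parity _                 = zero

    vertex : V → Fin (2 * k)
    vertex x = pairVertex (colour x) (parity x)

    pairIndex-vertex : ∀ x → pairIndex (vertex x) ≡ toℕ (colour x)
    pairIndex-vertex x = pairIndex-pairVertex (colour x) (parity x)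

    vertex-≢ : ∀ x → let (a , b) = ends x in colour a ≢ colour b → vertex a ≢ vertex b
    vertex-≢ x ca≢cb eq = ca≢cb (toℕ-injective (begin
      toℕ (colour a)       ≡⟨ pairIndex-vertex a ⟨
      pairIndex (vertex a) ≡⟨ cong pairIndex eq ⟩
      pairIndex (vertex b) ≡⟨ pairIndex-vertex b ⟩
      toℕ (colour b)       ∎))
      where
      a = proj₁ (ends x)
      b = proj₂ (ends x)

    distinct : ∀ x → vertex (proj₁ (ends x)) ≢ vertex (proj₂ (ends x))
    distinct (e , true , false) eq with () ← pairVertex-injectiveʳ (colour (inj₁ (proj₁ (proj₁ e)))) eq
    distinct x@(((u , v) , _ , uv) , true , true) = vertex-≢ x (proper u v uv ∘ sym)
    distinct x@(e , false , false) = vertex-≢ x (proj₁ (proj₂ (fresh e)) ∘ sym)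
    distinct x@(e , false , true)  = vertex-≢ x (proj₂ (proj₂ (fresh e)) ∘ sym)

    colourSign : ∀ x → matchSign (toℕ (colour (proj₁ (ends x)))) (toℕ (colour (proj₂ (ends x)))) ≡ σ x
    colourSign (e , true , false) = matchSign-refl (toℕ (c (proj₁ (proj₁ e))))
    colourSign (((u , v) , _ , uv) , true , true) = matchSign-≢ (proper u v uv ∘ sym ∘ toℕ-injective)
    colourSign (e , false , false) = matchSign-≢ (proj₁ (proj₂ (fresh e)) ∘ sym ∘ toℕ-injective)
    colourSign (e , false , true)  = matchSign-≢ (proj₂ (proj₂ (fresh e)) ∘ sym ∘ toℕ-injective)

    σ-pres : ∀ x → matchSign (pairIndex (vertex (proj₁ (ends x)))) (pairIndex (vertex (proj₂ (ends x)))) ≡ σ x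
    σ-pres x = trans (cong₂ matchSign (pairIndex-vertex _) (pairIndex-vertex _)) (colourSign x)

corollary2p5 : (k : ℕ) → 3 ≤ k → (G : Graph) → Colourable G k ⇔ Hom (S G) (KM k)
corollary2p5 k 3≤k G = mk⇔ (Colourable⇒Hom G 3≤k) (Hom⇒Colourable G)
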